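{- There are no antipodal bipartite distance-regular dicirculants with diameter $4$; that is, no Cayley graph on a dicyclic group $\mathrm{Dic}_n$ ($n\ge1$) is an antipodal, bipartite distance-regular graph of diameter $4$.
   Context: $\mathrm{Dic}_n=\langle \alpha,\beta \mid \alpha^{2n}=1,\ \beta^2=\alpha^n,\ \beta^{ -1}\alpha\beta=\alpha^{ -1}\rangle$, of order $4n$. For a group $G$ and $S\subseteq G\setminus\{1\}$ with $S=S^{ -1}$, $\mathrm{Cay}(G,S)$ has vertex set $G$, with $g,h$ adjacent iff $g^{ -1}h\in S$. A connected graph of diameter $d$ is distance-regular if for vertices $u,v$ at distance $i$ the numbers of neighbours of $v$ at distance $i-1,i,i+1$ from $u$ depend only on $i$; it is antipodal if the relation "$\partial(u,v)\in\{0,d\}$" is an equivalence relation on vertices. -}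

module Defs where

open import Data.Nat using (ℕ; zero; suc; _+_; _*_; _∸_; NonZero)
open import Data.Nat.DivMod using (_%_; m%n<n)
open import Data.Nat.Properties using (m*n≢0)
open import Data.Fin using (Fin; toℕ; fromℕ<)
import Data.Fin.Properties as FinP
open import Data.Bool using (Bool; true; false; _∧_; _∨_; not)
import Data.Bool.Properties as BoolP
open import Data.List using (List; []; _∷_; concatMap; filterᵇ; length; allFin)
open import Data.Bool.ListAction using (any; all)
open import Data.Product using (_×_; _,_; ∃)
open import Relation.Binary.PropositionalEquality using (_≡_; refl; cong₂)
open import Relation.Binary.Structures using (IsEquivalence)
open import Relation.Nullary using (Dec; yes; no)
open import Relation.Nullary.Decidable using (⌊_⌋)

-- The dicyclic group Dic_n = ⟨ α, β ∣ α^{2n} = 1, β² = αⁿ, β⁻¹αβ = α⁻¹ ⟩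
-- (order 4n).  Every element is uniquely α^i β^b with i ∈ ℤ/2n,
-- b ∈ {0,1}; we represent it by (i , b), i : Fin (2n), b : Bool
-- (b = true meaning the factor β is present).

module Dicyclic (n : ℕ) {{nz : NonZero n}} where

  instance
    nz2n : NonZero (2 * n)
    nz2n = m*n≢0 2 n

  Dic : Set
  Dic = Fin (2 * n) × Bool

  md : ℕ → Fin (2 * n)
  md k = fromℕ< (m%n<n k (2 * n))

  neg : Fin (2 * n) → ℕ
  neg k = 2 * n ∸ toℕ k

  one : Dic
  one = md 0 , false

  -- (α^i β^a)(α^k β^b), using  β α^k = α^{-k} β  and  β² = αⁿ
  _·_ : Dic → Dic → Dic
  (i , false) · (k , b)     = md (toℕ i + toℕ k) , b
  (i , true)  · (k , false) = md (toℕ i + neg k) , true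
  (i , true)  · (k , true)  = md (toℕ i + neg k + n) , false

  inv : Dic → Dic
  inv (i , false) = md (neg i) , false
  inv (i , true)  = md (toℕ i + n) , true

  _≟_ : (g h : Dic) → Dec (g ≡ h)
  (i , a) ≟ (k , b) with i FinP.≟ k | a BoolP.≟ b
  ... | yes p | yes q = yes (cong₂ _,_ p q)
  ... | no ¬p | _     = no λ { refl → ¬p refl }
  ... | yes _ | no ¬q = no λ { refl → ¬q refl }

  elements : List Dic
  elements = concatMap (λ i → (i , false) ∷ (i , true) ∷ []) (allFin (2 * n))

  cayAdj : (Dic → Bool) → Dic → Dic → Bool
  cayAdj S g h = S (inv g · h)

  ConnectionSet : (Dic → Bool) → Set
  ConnectionSet S = (S one ≡ false) × (∀ g → S g ≡ S (inv g))

-- Graph notions for a finite graph given by a complete, duplicate-free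
-- list of its vertices and a Boolean adjacency relation.

module FiniteGraph {V : Set} (elems : List V) (_≟_ : (u v : V) → Dec (u ≡ v))
                   (adj : V → V → Bool) where

  within : ℕ → V → V → Bool
  within zero    u v = ⌊ u ≟ v ⌋
  within (suc k) u v = within k u v ∨ any (λ w → within k u w ∧ adj w v) elems

  isDist : ℕ → V → V → Bool
  isDist zero    u v = within zero u v
  isDist (suc i) u v = within (suc i) u v ∧ not (within i u v)

  Dist : ℕ → V → V → Set
  Dist i u v = isDist i u v ≡ true

  Adj : V → V → Set
  Adj u v = adj u v ≡ true

  ConnectedOfDiameter : ℕ → Set
  ConnectedOfDiameter d = (∀ u v → within d u v ≡ true) × ∃ λ u → ∃ λ v → Dist d u v

  count : ℕ → V → V → ℕ
  count j u v = length (filterᵇ (λ w → adj v w ∧ isDist j u w) elems)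

  IntersectionRegular : Set
  IntersectionRegular = ∀ i u v u′ v′ → Dist i u v → Dist i u′ v′ →
      (∀ j → suc j ≡ i → count j u v ≡ count j u′ v′)
    × (count i u v ≡ count i u′ v′)
    × (count (suc i) u v ≡ count (suc i) u′ v′)

  DistanceRegularOfDiameter : ℕ → Set
  DistanceRegularOfDiameter d = ConnectedOfDiameter d × IntersectionRegular

  Antipodal : ℕ → Set
  Antipodal d = IsEquivalence (λ u v → (isDist 0 u v ∨ isDist d u v) ≡ true)

  Bipartite : Set
  Bipartite = ∃ λ (c : V → Bool) → ∀ u v → Adj u v → c u ≡ not (c v)

module CayDic (n : ℕ) {{nz : NonZero n}} (S : Dicyclic.Dic n → Bool) =
  FiniteGraph (Dicyclic.elements n) (Dicyclic._≟_ n) (Dicyclic.cayAdj n S)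

{-# OPTIONS --safe #-}
-- Suppose Cay(Dic_n, S) is antipodal, bipartite and distance-regular of diameter 4. Left
-- translations are automorphisms, so everything is read off at the vertex 1. S contains some
-- x = αⁱβ (otherwise the graph stays inside ⟨α⟩), and x² = αⁿ = z, so z is at distance 2 from 1
-- (a triangle would not be bipartite). No αⁱβ is an antipode of 1, since then 1 and its square z
-- would be antipodes; and S cannot avoid ⟨α⟩, since b₂ would vanish at z. Hence the colouring is
-- the parity of the exponent of α (shifted by a constant on ⟨α⟩β), and the antipodes h ≠ h⁻¹ of 1
-- lie in ⟨α⟩. Let a = |S ∩ ⟨α⟩|, b = |S ∩ ⟨α⟩β|, k = a + b and c = c₂. A vertex x has k
-- neighbours in S if x = 1, c if ∂(1, x) = 2 and none otherwise, so counting the edges between S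
-- and each coset gives 2ab = nc and a² + b² ≤ k + (n - 3)c. Hence (a - b)² + 3c ≤ a + b, which is
-- impossible since 1 ≤ b ≤ c.
module Submission where

open import Defs
open import Data.Nat using (ℕ; NonZero)
open import Data.Bool using (Bool)
open import Data.Product using (_×_; _,_)
open import Relation.Nullary using (¬_)

module Sums where
  open import Data.Bool using (Bool; true; false)
  open import Data.Fin using (Fin; zero; suc; toℕ)
  open import Data.Fin.Properties using (_≟_)
  open import Data.List using (List; []; _∷_; map; filterᵇ; length; tabulate)
  open import Data.List.Membership.Propositional using (_∈_)
  open import Data.List.Membership.Propositional.Properties using (∈-map⁺)
  open import Data.List.Membership.Propositional.Properties.WithK using (unique∧set⇒bag)
  open import Data.List.Relation.Binary.BagAndSetEquality using (∼bag⇒↭)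
  import Data.List.Relation.Binary.Permutation.Propositional.Properties as Permutation
  open import Data.List.Relation.Unary.Any using (here; there)
  open import Data.List.Relation.Unary.Unique.Propositional using (Unique)
  import Data.List.Relation.Unary.Unique.Propositional.Properties as Unique
  open import Data.Nat using (ℕ; zero; suc; _+_; _*_; _≤_; z≤n)
  open import Data.Nat.ListAction using (sum)
  open import Data.Nat.ListAction.Properties using (sum-↭)
  import Data.Nat.Properties as ℕₚ
  open import Data.Nat.Tactic.RingSolver using (solve-∀)
  open import Data.Product using (∃; proj₁; proj₂)
  open import Function.Bundles using (mk⇔)
  open import Relation.Binary.PropositionalEquality
  open import Relation.Nullary.Decidable using (⌊_⌋; yes; no)
  open import Algebra.Properties.Semiring.Sum ℕₚ.+-*-semiring
    using (sum-syntax; sum-cong-≗; sum-replicate-zero) renaming (sum to ∑)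

  private variable A B : Set

  𝟙 : Bool → ℕ
  𝟙 true  = 1
  𝟙 false = 0

  Σ[_]_ : List A → (A → ℕ) → ℕ
  Σ[ L ] f = sum (map f L)

  Σ-cong : ∀ (L : List A) {f g : A → ℕ} → (∀ x → f x ≡ g x) → Σ[ L ] f ≡ Σ[ L ] g
  Σ-cong []      f≗g = refl
  Σ-cong (x ∷ L) f≗g = cong₂ _+_ (f≗g x) (Σ-cong L f≗g)

  Σ-mono : ∀ (L : List A) {f g : A → ℕ} → (∀ x → f x ≤ g x) → Σ[ L ] f ≤ Σ[ L ] g
  Σ-mono []      f≤g = z≤n
  Σ-mono (x ∷ L) f≤g = ℕₚ.+-mono-≤ (f≤g x) (Σ-mono L f≤g)

  Σ-zero : ∀ (L : List A) → Σ[ L ] (λ _ → 0) ≡ 0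
  Σ-zero []      = refl
  Σ-zero (x ∷ L) = Σ-zero L

  Σ-+ : ∀ (L : List A) (f g : A → ℕ) → Σ[ L ] (λ x → f x + g x) ≡ Σ[ L ] f + Σ[ L ] g
  Σ-+ []      f g = refl
  Σ-+ (x ∷ L) f g = trans (cong (f x + g x +_) (Σ-+ L f g)) (lemma (f x) (g x) (Σ[ L ] f) (Σ[ L ] g))
    where lemma : ∀ a b c d → a + b + (c + d) ≡ a + c + (b + d)
          lemma = solve-∀

  Σ-*ʳ : ∀ (L : List A) (f : A → ℕ) c → Σ[ L ] (λ x → f x * c) ≡ Σ[ L ] f * c
  Σ-*ʳ []      f c = refl
  Σ-*ʳ (x ∷ L) f c = trans (cong (f x * c +_) (Σ-*ʳ L f c)) (sym (ℕₚ.*-distribʳ-+ c (f x) _))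

  Σ-swap : ∀ (L : List A) (K : List B) (F : A → B → ℕ) →
           Σ[ L ] (λ x → Σ[ K ] (F x)) ≡ Σ[ K ] (λ y → Σ[ L ] (λ x → F x y))
  Σ-swap []      K F = sym (Σ-zero K)
  Σ-swap (x ∷ L) K F = trans (cong (Σ[ K ] (F x) +_) (Σ-swap L K F)) (sym (Σ-+ K (F x) _))

  Σ-map : ∀ (L : List A) (f : A → B) (h : B → ℕ) → Σ[ map f L ] h ≡ Σ[ L ] (λ x → h (f x))
  Σ-map []      f h = refl
  Σ-map (x ∷ L) f h = cong (h (f x) +_) (Σ-map L f h)

  Σ-≥-term : ∀ (L : List A) (f : A → ℕ) {x} → x ∈ L → f x ≤ Σ[ L ] f
  Σ-≥-term (y ∷ L) f (here refl) = ℕₚ.m≤m+n (f y) _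
  Σ-≥-term (y ∷ L) f (there x∈L) = ℕₚ.≤-trans (Σ-≥-term L f x∈L) (ℕₚ.m≤n+m _ (f y))

  length-filterᵇ : ∀ (P : A → Bool) (L : List A) → length (filterᵇ P L) ≡ Σ[ L ] (λ x → 𝟙 (P x))
  length-filterᵇ P []      = refl
  length-filterᵇ P (x ∷ L) with P x
  ... | true  = cong suc (length-filterᵇ P L)
  ... | false = length-filterᵇ P L

  Σ-bijection : ∀ (L : List A) → Unique L → (∀ x → x ∈ L) →
                (f : A → A) → (∀ {x y} → f x ≡ f y → x ≡ y) → (∀ y → ∃ λ x → f x ≡ y) →
                (h : A → ℕ) → Σ[ L ] (λ x → h (f x)) ≡ Σ[ L ] h
  Σ-bijection L unique complete f injective surjective h =
    trans (sym (Σ-map L f h)) (sum-↭ (Permutation.map⁺ h f[L]↭L))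
    where
      f[L]↭L = ∼bag⇒↭ (unique∧set⇒bag (Unique.map⁺ injective unique) unique (λ {y} → mk⇔
        (λ _ → complete y)
        (λ _ → subst (_∈ map f L) (proj₂ (surjective y)) (∈-map⁺ f (complete (proj₁ (surjective y)))))))

  Σ-tabulate : ∀ {m} (f : Fin m → B) (h : B → ℕ) → Σ[ tabulate f ] h ≡ ∑[ i < m ] h (f i)
  Σ-tabulate {m = zero}  f h = refl
  Σ-tabulate {m = suc m} f h = cong (h (f zero) +_) (Σ-tabulate (λ i → f (suc i)) h)

  ∑-mono : ∀ {m} {f g : Fin m → ℕ} → (∀ i → f i ≤ g i) → ∑[ i < m ] f i ≤ ∑[ i < m ] g i
  ∑-mono {zero}  f≤g = z≤n
  ∑-mono {suc m} f≤g = ℕₚ.+-mono-≤ (f≤g zero) (∑-mono (λ i → f≤g (suc i)))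

  ∑-𝟙-≟ : ∀ {m} (j : Fin m) → ∑[ i < m ] 𝟙 ⌊ i ≟ j ⌋ ≡ 1
  ∑-𝟙-≟ {suc m} zero    = cong suc (sum-replicate-zero m)
  ∑-𝟙-≟ {suc m} (suc j) = trans (sum-cong-≗ {m} (λ i → 𝟙-≟-suc i j)) (∑-𝟙-≟ j)
    where
      𝟙-≟-suc : ∀ {m} (i j : Fin m) → 𝟙 ⌊ suc i ≟ suc j ⌋ ≡ 𝟙 ⌊ i ≟ j ⌋
      𝟙-≟-suc i j with i ≟ j
      ... | yes _ = refl
      ... | no _  = refl

  ∑-periodic₂ : ∀ (g : ℕ → ℕ) → (∀ j → g (2 + j) ≡ g j) → ∀ m → ∑[ i < 2 * m ] g (toℕ i) ≡ m * (g 0 + g 1)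
  ∑-periodic₂ g periodic zero    = refl
  ∑-periodic₂ g periodic (suc m) = begin
    ∑[ i < 2 * suc m ] g (toℕ i)                        ≡⟨ cong (λ k → ∑[ i < k ] g (toℕ i)) (ℕₚ.*-suc 2 m) ⟩
    g 0 + (g 1 + ∑[ i < 2 * m ] g (2 + toℕ i))          ≡⟨ cong (λ r → g 0 + (g 1 + r)) (∑-periodic₂ (λ j → g (2 + j)) (λ j → periodic (2 + j)) m) ⟩
    g 0 + (g 1 + m * (g 2 + g 3))                       ≡⟨ cong (λ r → g 0 + (g 1 + m * r)) (cong₂ _+_ (periodic 0) (periodic 1)) ⟩
    g 0 + (g 1 + m * (g 0 + g 1))                       ≡⟨ lemma (g 0) (g 1) m ⟩
    suc m * (g 0 + g 1)                                 ∎
    where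
      open ≡-Reasoning
      lemma : ∀ a b m → a + (b + m * (a + b)) ≡ suc m * (a + b)
      lemma = solve-∀

module FiniteGraphs where
  open Sums
  open import Data.Bool using (Bool; true; false; not; _∧_; _∨_; _xor_)
  open import Data.Bool.ListAction using (any)
  import Data.Bool.Properties as Boolₚ
  open import Data.Empty using (⊥-elim)
  open import Data.List using (List)
  open import Data.List.Membership.Propositional using (_∈_; find; lose)
  open import Data.List.Relation.Unary.Any.Properties using (any⁺; any⁻)
  open import Data.Nat using (ℕ; zero; suc; _+_; _∸_; _≤_; _<_; z≤n; s≤s)
  import Data.Nat.Properties as ℕₚ
  open import Data.Product using (∃; _×_; _,_; proj₁; proj₂)
  open import Data.Sum using (_⊎_; inj₁; inj₂)
  open import Function.Bundles using (Equivalence)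
  open import Relation.Binary.PropositionalEquality
  open import Relation.Binary.Structures using (IsEquivalence)
  open import Relation.Nullary using (¬_; Dec; yes; no)
  open import Relation.Nullary.Decidable using (⌊_⌋)

  ∧-true : ∀ {a b} → a ∧ b ≡ true → a ≡ true × b ≡ true
  ∧-true {true} {true} refl = refl , refl

  ∨-true : ∀ {a b} → a ∨ b ≡ true → a ≡ true ⊎ b ≡ true
  ∨-true {true}  refl = inj₁ refl
  ∨-true {false} eq   = inj₂ eq

  ∨-resolveˡ : ∀ {a b} → a ∨ b ≡ true → a ≡ false → b ≡ true
  ∨-resolveˡ eq refl = eq

  ∨-trueʳ : ∀ a {b} → b ≡ true → a ∨ b ≡ true
  ∨-trueʳ false eq = eq
  ∨-trueʳ true  eq = refl

  ¬true⇒false : ∀ {b} → ¬ b ≡ true → b ≡ false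
  ¬true⇒false = Boolₚ.¬-not

  ∧-not-true : ∀ {a b} → a ≡ true → b ≡ false → a ∧ not b ≡ true
  ∧-not-true refl refl = refl

  true-ext : ∀ {a b} → (a ≡ true → b ≡ true) → (b ≡ true → a ≡ true) → a ≡ b
  true-ext {false} {false} _ _ = refl
  true-ext {false} {true}  _ g = g refl
  true-ext {true}  {false} f _ = sym (f refl)
  true-ext {true}  {true}  _ _ = refl

  isOdd : ℕ → Bool
  isOdd zero    = false
  isOdd (suc j) = not (isOdd j)

  true≢false : true ≢ false
  true≢false ()

  any-true⇒ : ∀ {A : Set} (P : A → Bool) L → any P L ≡ true → ∃ λ x → x ∈ L × P x ≡ true
  any-true⇒ P L eq with find (any⁻ P L (Equivalence.from Boolₚ.T-≡ eq))
  ... | x , x∈L , Px = x , x∈L , Equivalence.to Boolₚ.T-≡ Px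

  any-true⇐ : ∀ {A : Set} (P : A → Bool) {L x} → x ∈ L → P x ≡ true → any P L ≡ true
  any-true⇐ P x∈L Px = Equivalence.to Boolₚ.T-≡ (any⁺ P (lose x∈L (Equivalence.from Boolₚ.T-≡ Px)))

  search : ∀ {A : Set} (P : A → Bool) L → (∀ x → x ∈ L) → (∃ λ x → P x ≡ true) ⊎ (∀ x → P x ≡ false)
  search P L complete with any P L in eq
  ... | true  = let x , _ , Px = any-true⇒ P L eq in inj₁ (x , Px)
  ... | false = inj₂ λ x → ¬true⇒false λ Px → true≢false (trans (sym (any-true⇐ P (complete x) Px)) eq)

  ⌊≟⌋-true⇒ : ∀ {V : Set} (_≟_ : (u v : V) → Dec (u ≡ v)) {u v} → ⌊ u ≟ v ⌋ ≡ true → u ≡ v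
  ⌊≟⌋-true⇒ _≟_ {u} {v} eq with u ≟ v
  ... | yes u≡v = u≡v

  ⌊≟⌋-refl : ∀ {V : Set} (_≟_ : (u v : V) → Dec (u ≡ v)) u → ⌊ u ≟ u ⌋ ≡ true
  ⌊≟⌋-refl _≟_ u with u ≟ u
  ... | yes _  = refl
  ... | no u≢u = ⊥-elim (u≢u refl)

  ⌊≟⌋-false : ∀ {V : Set} (_≟_ : (u v : V) → Dec (u ≡ v)) {u v} → u ≢ v → ⌊ u ≟ v ⌋ ≡ false
  ⌊≟⌋-false _≟_ {u} {v} u≢v with u ≟ v
  ... | yes u≡v = ⊥-elim (u≢v u≡v)
  ... | no _    = refl

  module FiniteGraphProperties {V : Set} (elems : List V) (_≟_ : (u v : V) → Dec (u ≡ v))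
                               (adj : V → V → Bool) (complete : ∀ v → v ∈ elems) where
    open FiniteGraph elems _≟_ adj

    within-suc : ∀ k u w → within k u w ≡ true → within (suc k) u w ≡ true
    within-suc k u w eq rewrite eq = refl

    within-+ : ∀ j k u w → within k u w ≡ true → within (j + k) u w ≡ true
    within-+ zero    k u w eq = eq
    within-+ (suc j) k u w eq = within-suc (j + k) u w (within-+ j k u w eq)

    within-refl : ∀ k u → within k u u ≡ true
    within-refl zero    u = ⌊≟⌋-refl _≟_ u
    within-refl (suc k) u = within-suc k u u (within-refl k u)

    within-step : ∀ k u y w → within k u y ≡ true → Adj y w → within (suc k) u w ≡ true
    within-step k u y w wy ay = ∨-trueʳ (within k u w)
      (any-true⇐ (λ y′ → within k u y′ ∧ adj y′ w) (complete y) (cong₂ _∧_ wy ay))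

    Adj⇒within-1 : ∀ u w → Adj u w → within 1 u w ≡ true
    Adj⇒within-1 u w = within-step 0 u u w (within-refl 0 u)

    Dist-0⇒≡ : ∀ u w → Dist 0 u w → u ≡ w
    Dist-0⇒≡ u w = ⌊≟⌋-true⇒ _≟_

    Dist⇒within : ∀ d u w → Dist d u w → within d u w ≡ true
    Dist⇒within zero    u w D = D
    Dist⇒within (suc d) u w D = proj₁ (∧-true {within (suc d) u w} D)

    within⇒¬Dist-suc : ∀ k u w → within k u w ≡ true → ¬ Dist (suc k) u w
    within⇒¬Dist-suc k u w eq D with () ← trans (cong not (sym eq)) (proj₂ (∧-true {within (suc k) u w} D))

    Dist-suc⇒¬within : ∀ k u w → Dist (suc k) u w → within k u w ≡ false
    Dist-suc⇒¬within k u w D = ¬true⇒false λ eq → within⇒¬Dist-suc k u w eq D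

    Dist⇒¬Dist-suc : ∀ {d k} u w → d ≤ k → Dist d u w → ¬ Dist (suc k) u w
    Dist⇒¬Dist-suc {d} {k} u w d≤k D = within⇒¬Dist-suc k u w
      (subst (λ m → within m u w ≡ true) (ℕₚ.m∸n+n≡m d≤k) (within-+ (k ∸ d) d u w (Dist⇒within d u w D)))

    ¬Dist-suc-refl : ∀ k u → ¬ Dist (suc k) u u
    ¬Dist-suc-refl k u = within⇒¬Dist-suc k u u (within-refl k u)

    within⇒Dist : ∀ k u w → within k u w ≡ true → ∃ λ d → d ≤ k × Dist d u w
    within⇒Dist zero    u w eq = 0 , z≤n , eq
    within⇒Dist (suc k) u w eq with within k u w Boolₚ.≟ true
    ... | yes eqₖ = let d , d≤k , D = within⇒Dist k u w eqₖ in d , ℕₚ.m≤n⇒m≤1+n d≤k , D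
    ... | no ¬eqₖ = suc k , ℕₚ.≤-refl , ∧-not-true eq (¬true⇒false ¬eqₖ)

    within⇒Dist-exact : ∀ k u w → within k u w ≡ true → (∀ d → d < k → ¬ Dist d u w) → Dist k u w
    within⇒Dist-exact zero    u w eq _      = eq
    within⇒Dist-exact (suc k) u w eq closer = ∧-not-true eq (¬true⇒false λ wk →
      let d , d≤k , D = within⇒Dist k u w wk in closer d (s≤s d≤k) D)

    Dist-suc⇒pred : ∀ k u w → Dist (suc k) u w → ∃ λ y → Dist k u y × Adj y w
    Dist-suc⇒pred k u w D
      with any-true⇒ (λ y → within k u y ∧ adj y w) elems
             (∨-resolveˡ (Dist⇒within (suc k) u w D) (Dist-suc⇒¬within k u w D))
    ... | y , _ , eq = let wy , ay = ∧-true eq in y , last-step k y wy ay (Dist-suc⇒¬within k u w D) , ay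
      where
        last-step : ∀ k y → within k u y ≡ true → Adj y w → within k u w ≡ false → Dist k u y
        last-step zero    y wy _  _   = wy
        last-step (suc j) y wy ay ¬ww = ∧-not-true wy (¬true⇒false λ wj →
          true≢false (trans (sym (within-step j u y w wj ay)) ¬ww))

    isDist-1 : (∀ u → adj u u ≡ false) → ∀ u w → isDist 1 u w ≡ adj u w
    isDist-1 irreflexive u w with u ≟ w
    ... | yes refl = sym (irreflexive u)
    ... | no u≢w   = trans (Boolₚ.∧-identityʳ _) (true-ext to from)
      where
        P : V → Bool
        P y = ⌊ u ≟ y ⌋ ∧ adj y w
        to : any P elems ≡ true → adj u w ≡ true
        to eq with any-true⇒ P elems eq
        ... | y , _ , Py = let u≟y , ay = ∧-true Py in subst (λ x → adj x w ≡ true) (sym (⌊≟⌋-true⇒ _≟_ u≟y)) ay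
        from : adj u w ≡ true → any P elems ≡ true
        from auw = any-true⇐ P (complete u) (cong₂ _∧_ (⌊≟⌋-refl _≟_ u) auw)

    module Automorphism (f : V → V) (injective : ∀ {u w} → f u ≡ f w → u ≡ w)
                        (surjective : ∀ y → ∃ λ x → f x ≡ y)
                        (adj-f : ∀ u w → adj (f u) (f w) ≡ adj u w) where

      within-preserved : ∀ k u w → within k (f u) (f w) ≡ within k u w
      within-preserved zero u w with f u ≟ f w | u ≟ w
      ... | yes _      | yes _ = refl
      ... | no _       | no _  = refl
      ... | yes fu≡fw  | no u≢w = ⊥-elim (u≢w (injective fu≡fw))
      ... | no fu≢fw   | yes u≡w = ⊥-elim (fu≢fw (cong f u≡w))
      within-preserved (suc k) u w = cong₂ _∨_ (within-preserved k u w) (true-ext to from)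
        where
          step-preserved : ∀ x → (within k (f u) (f x) ∧ adj (f x) (f w)) ≡ (within k u x ∧ adj x w)
          step-preserved x = cong₂ _∧_ (within-preserved k u x) (adj-f x w)
          to : any (λ y → within k (f u) y ∧ adj y (f w)) elems ≡ true →
               any (λ x → within k u x ∧ adj x w) elems ≡ true
          to eq with any-true⇒ _ elems eq
          ... | y , _ , eqʸ with surjective y
          ... | x , refl = any-true⇐ _ (complete x) (trans (sym (step-preserved x)) eqʸ)
          from : any (λ x → within k u x ∧ adj x w) elems ≡ true →
                 any (λ y → within k (f u) y ∧ adj y (f w)) elems ≡ true
          from eq with any-true⇒ _ elems eq
          ... | x , _ , eqˣ = any-true⇐ _ (complete (f x)) (trans (step-preserved x) eqˣ)

      isDist-preserved : ∀ d u w → isDist d (f u) (f w) ≡ isDist d u w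
      isDist-preserved zero    u w = within-preserved zero u w
      isDist-preserved (suc d) u w = cong₂ _∧_ (within-preserved (suc d) u w) (cong not (within-preserved d u w))

    Dist⇒colour-xor : (col : V → Bool) → (∀ u w → Adj u w → col u ≡ not (col w)) →
                      ∀ d u w → Dist d u w → col u xor col w ≡ isOdd d
    Dist⇒colour-xor col proper zero u w D =
      trans (cong (λ x → col u xor col x) (sym (Dist-0⇒≡ u w D))) (Boolₚ.xor-same (col u))
    Dist⇒colour-xor col proper (suc d) u w D with Dist-suc⇒pred d u w D
    ... | y , Dʸ , ay = begin
      col u xor col w                  ≡⟨ cong (col u xor_) (Boolₚ.not-involutive (col w)) ⟨
      col u xor not (not (col w))      ≡⟨ cong (λ c → col u xor not c) (proper y w ay) ⟨
      col u xor not (col y)            ≡⟨ Boolₚ.not-distribʳ-xor (col u) (col y) ⟨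
      not (col u xor col y)            ≡⟨ cong not (Dist⇒colour-xor col proper d u y Dʸ) ⟩
      isOdd (suc d)                    ∎
      where open ≡-Reasoning

    Antipodal⇒Dist-sym : ∀ k → Antipodal (suc k) → ∀ u w → Dist (suc k) u w → Dist (suc k) w u
    Antipodal⇒Dist-sym k antipodal u w D = ∨-resolveˡ (IsEquivalence.sym antipodal {u} {w} (∨-trueʳ _ D))
      (⌊≟⌋-false _≟_ λ w≡u → ¬Dist-suc-refl k u (subst (Dist (suc k) u) w≡u D))

    count-Σ : ∀ j u v → count j u v ≡ Σ[ elems ] (λ w → 𝟙 (adj v w ∧ isDist j u w))
    count-Σ j u v = length-filterᵇ _ elems

    count-pos : ∀ j u v w → Adj v w → Dist j u w → 1 ≤ count j u v
    count-pos j u v w avw D = begin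
      1                                              ≡⟨ cong 𝟙 (sym (cong₂ _∧_ avw D)) ⟩
      𝟙 (adj v w ∧ isDist j u w)                     ≤⟨ Σ-≥-term elems _ (complete w) ⟩
      Σ[ elems ] (λ x → 𝟙 (adj v x ∧ isDist j u x))  ≡⟨ count-Σ j u v ⟨
      count j u v                                    ∎
      where open ℕₚ.≤-Reasoning

    count-zero : ∀ j u v → (∀ w → Adj v w → ¬ Dist j u w) → count j u v ≡ 0
    count-zero j u v none = trans (count-Σ j u v) (trans (Σ-cong elems λ w →
      cong 𝟙 (¬true⇒false λ eq → let avw , D = ∧-true eq in none w avw D)) (Σ-zero elems))

module SquareBounds where
  open import Data.Nat using (zero; suc; _+_; _*_; _≤_; z≤n)
  import Data.Nat.Properties as ℕₚ
  open import Data.Nat.Tactic.RingSolver using (solve-∀)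
  open import Data.Product using (_,_)
  open import Data.Sum using (inj₁; inj₂)
  open import Relation.Binary.PropositionalEquality
  open import Relation.Nullary using (¬_)

  square-≤-linear : ∀ e c x → 1 ≤ c → x ≤ 2 * c → ¬ (e * e + 3 * c ≤ x + e)
  square-≤-linear e c x 1≤c x≤2c le = ℕₚ.<-irrefl refl (begin-strict
    e          ≤⟨ e≤e*e e ⟩
    e * e      <⟨ ℕₚ.m<m+n (e * e) 1≤c ⟩
    e * e + c  ≤⟨ ℕₚ.+-cancelʳ-≤ (2 * c) _ _ (begin
      e * e + c + 2 * c  ≡⟨ lemma e c ⟩
      e * e + 3 * c      ≤⟨ le ⟩
      x + e              ≤⟨ ℕₚ.+-monoˡ-≤ e x≤2c ⟩
      2 * c + e          ≡⟨ ℕₚ.+-comm (2 * c) e ⟩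
      e + 2 * c          ∎) ⟩
    e          ∎)
    where
      open ℕₚ.≤-Reasoning
      e≤e*e : ∀ e → e ≤ e * e
      e≤e*e zero    = z≤n
      e≤e*e (suc e) = ℕₚ.m≤m*n (suc e) (suc e)
      lemma : ∀ e c → e * e + c + 2 * c ≡ e * e + 3 * c
      lemma = solve-∀

  private
    square-bound-≥ : ∀ b d c → 1 ≤ b → b ≤ c →
                     ¬ ((b + d) * (b + d) + b * b + 3 * c ≤ 2 * ((b + d) * b) + ((b + d) + b))
    square-bound-≥ b d c 1≤b b≤c le =
      square-≤-linear d c (2 * b) (ℕₚ.≤-trans 1≤b b≤c) (ℕₚ.*-monoʳ-≤ 2 b≤c)
        (ℕₚ.+-cancelˡ-≤ (2 * (b * b + b * d)) _ _ (begin
          2 * (b * b + b * d) + (d * d + 3 * c)      ≡⟨ lhs b d c ⟩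
          (b + d) * (b + d) + b * b + 3 * c          ≤⟨ le ⟩
          2 * ((b + d) * b) + ((b + d) + b)          ≡⟨ rhs b d ⟩
          2 * (b * b + b * d) + (2 * b + d)          ∎))
      where
        open ℕₚ.≤-Reasoning
        lhs : ∀ b d c → 2 * (b * b + b * d) + (d * d + 3 * c) ≡ (b + d) * (b + d) + b * b + 3 * c
        lhs = solve-∀
        rhs : ∀ b d → 2 * ((b + d) * b) + ((b + d) + b) ≡ 2 * (b * b + b * d) + (2 * b + d)
        rhs = solve-∀

    square-bound-≤ : ∀ a d c → 1 ≤ a + d → a + d ≤ c →
                     ¬ (a * a + (a + d) * (a + d) + 3 * c ≤ 2 * (a * (a + d)) + (a + (a + d)))
    square-bound-≤ a d c 1≤a+d a+d≤c le =
      square-≤-linear d c (2 * a) (ℕₚ.≤-trans 1≤a+d a+d≤c) (ℕₚ.*-monoʳ-≤ 2 (ℕₚ.≤-trans (ℕₚ.m≤m+n a d) a+d≤c))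
        (ℕₚ.+-cancelˡ-≤ (2 * (a * a + a * d)) _ _ (begin
          2 * (a * a + a * d) + (d * d + 3 * c)      ≡⟨ lhs a d c ⟩
          a * a + (a + d) * (a + d) + 3 * c          ≤⟨ le ⟩
          2 * (a * (a + d)) + (a + (a + d))          ≡⟨ rhs a d ⟩
          2 * (a * a + a * d) + (2 * a + d)          ∎))
      where
        open ℕₚ.≤-Reasoning
        lhs : ∀ a d c → 2 * (a * a + a * d) + (d * d + 3 * c) ≡ a * a + (a + d) * (a + d) + 3 * c
        lhs = solve-∀
        rhs : ∀ a d → 2 * (a * (a + d)) + (a + (a + d)) ≡ 2 * (a * a + a * d) + (2 * a + d)
        rhs = solve-∀

  sum-of-squares-bound : ∀ a b c → 1 ≤ b → b ≤ c → ¬ (a * a + b * b + 3 * c ≤ 2 * (a * b) + (a + b))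
  sum-of-squares-bound a b c 1≤b b≤c with ℕₚ.≤-total b a
  ... | inj₁ b≤a with ℕₚ.m≤n⇒∃[o]m+o≡n b≤a
  ... | d , refl = square-bound-≥ b d c 1≤b b≤c
  sum-of-squares-bound a b c 1≤b b≤c | inj₂ a≤b with ℕₚ.m≤n⇒∃[o]m+o≡n a≤b
  ... | d , refl = square-bound-≤ a d c 1≤b b≤c

module DicyclicGroups where
  open Sums
  open import Algebra.Bundles using (Group)
  import Algebra.Properties.Group as GroupProperties
  open import Algebra.Structures using (IsGroup)
  open import Data.Bool using (Bool; true; false; not; _xor_)
  import Data.Bool.Properties as Boolₚ
  open import Data.Fin using (Fin; toℕ)
  import Data.Fin.Properties as Finₚ
  import Data.Integer
  import Data.Integer.Properties as ℤₚ
  open import Data.Integer.Tactic.RingSolver using (solve-∀)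
  open import Data.List using (List; []; _∷_; concatMap; allFin)
  open import Data.List.Membership.Propositional using (_∈_)
  open import Data.List.Membership.Propositional.Properties using (∈-concatMap⁺; ∈-allFin)
  open import Data.List.Relation.Unary.All using (All; []; _∷_)
  open import Data.List.Relation.Unary.AllPairs using ([]; _∷_)
  import Data.List.Relation.Unary.Any as Any
  open import Data.List.Relation.Unary.Any using (here; there)
  open import Data.List.Relation.Unary.Unique.Propositional using (Unique)
  import Data.List.Relation.Unary.Unique.Propositional.Properties as Unique
  open import Data.Nat as ℕ using (ℕ; suc; NonZero)
  import Data.Nat
  open import Data.Nat.DivMod
  import Data.Nat.Properties as ℕₚ
  open import Data.Product using (_×_; _,_; proj₁; proj₂; ∃)
  open import Data.Sum using (_⊎_; inj₁; inj₂)
  open import Function using (_∘_)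
  open import Level using (0ℓ)
  open import Relation.Binary.Bundles using (Setoid)
  open import Relation.Binary.PropositionalEquality
  import Relation.Binary.Reasoning.Setoid
  open import Relation.Nullary using (yes; no)
  open import Algebra.Properties.Semiring.Sum ℕₚ.+-*-semiring using (sum-syntax)

  -- The multiplication table of Dic_m on ℤ × Bool, the ℤ-component being read modulo 2m: the
  -- group laws hold there up to explicit multiples of 2m and are transported to Dic_n along emb.
  module IntegerModel (m : Data.Integer.ℤ) where
    open Data.Integer using (ℤ; +_; -_; _+_; _-_; _*_)

    infix 4 _≈_ _≋_

    record _≈_ (a b : ℤ) : Set where
      constructor by
      field
        quotient : ℤ
        equation : a ≡ b + quotient * (m + m)

    ≈-reflexive : ∀ {a b} → a ≡ b → a ≈ b
    ≈-reflexive {a} refl = by (+ 0) (lemma a m)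
      where lemma : ∀ a m → a ≡ a + + 0 * (m + m)
            lemma = solve-∀

    ≈-sym : ∀ {a b} → a ≈ b → b ≈ a
    ≈-sym {b = b} (by t refl) = by (- t) (lemma b t m)
      where lemma : ∀ b t m → b ≡ b + t * (m + m) + - t * (m + m)
            lemma = solve-∀

    ≈-trans : ∀ {a b c} → a ≈ b → b ≈ c → a ≈ c
    ≈-trans {c = c} (by t refl) (by s refl) = by (s + t) (lemma c s t m)
      where lemma : ∀ c s t m → c + s * (m + m) + t * (m + m) ≡ c + (s + t) * (m + m)
            lemma = solve-∀

    +-cong : ∀ {a a′ b b′} → a ≈ a′ → b ≈ b′ → a + b ≈ a′ + b′
    +-cong {a′ = a} {b′ = b} (by t refl) (by s refl) = by (t + s) (lemma a b t s m)
      where lemma : ∀ a b t s m → a + t * (m + m) + (b + s * (m + m)) ≡ a + b + (t + s) * (m + m)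
            lemma = solve-∀

    neg-cong : ∀ {a a′} → a ≈ a′ → - a ≈ - a′
    neg-cong {a′ = a} (by t refl) = by (- t) (lemma a t m)
      where lemma : ∀ a t m → - (a + t * (m + m)) ≡ - a + - t * (m + m)
            lemma = solve-∀

    Elem : Set
    Elem = ℤ × Bool

    data _≋_ : Elem → Elem → Set where
      _,_ : ∀ {a b c d} → a ≈ c → b ≡ d → (a , b) ≋ (c , d)

    ≋-refl : ∀ {x} → x ≋ x
    ≋-refl = ≈-reflexive refl , refl

    ≋-sym : ∀ {x y} → x ≋ y → y ≋ x
    ≋-sym (p , refl) = ≈-sym p , refl

    ≋-trans : ∀ {x y w} → x ≋ y → y ≋ w → x ≋ w
    ≋-trans (p , refl) (q , refl) = ≈-trans p q , refl

    ≋-setoid : Setoid 0ℓ 0ℓ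
    ≋-setoid = record
      { Carrier = Elem ; _≈_ = _≋_
      ; isEquivalence = record { refl = ≋-refl ; sym = ≋-sym ; trans = ≋-trans } }

    module ≋-Reasoning = Relation.Binary.Reasoning.Setoid ≋-setoid

    infixl 7 _∙_

    _∙_ : Elem → Elem → Elem
    (a , false) ∙ (c , b)     = a + c , b
    (a , true)  ∙ (c , false) = a - c , true
    (a , true)  ∙ (c , true)  = a - c + m , false

    _⁻¹ : Elem → Elem
    (a , false) ⁻¹ = - a , false
    (a , true)  ⁻¹ = a + m , true

    ∙-cong : ∀ {x x′ y y′} → x ≋ x′ → y ≋ y′ → x ∙ y ≋ x′ ∙ y′
    ∙-cong {_ , false} (p , refl) (q , refl) = +-cong p q , refl
    ∙-cong {_ , true} {y = _ , false} (p , refl) (q , refl) = +-cong p (neg-cong q) , refl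
    ∙-cong {_ , true} {y = _ , true} (p , refl) (q , refl) = +-cong (+-cong p (neg-cong q)) (≈-reflexive refl) , refl

    assoc : ∀ x y w → (x ∙ y) ∙ w ≋ x ∙ (y ∙ w)
    assoc (a , false) (c , false) (e , b) = by (+ 0) (lemma a c e m) , refl
      where lemma : ∀ a c e m → a + c + e ≡ a + (c + e) + + 0 * (m + m)
            lemma = solve-∀
    assoc (a , false) (c , true) (e , false) = by (+ 0) (lemma a c e m) , refl
      where lemma : ∀ a c e m → a + c - e ≡ a + (c - e) + + 0 * (m + m)
            lemma = solve-∀
    assoc (a , false) (c , true) (e , true) = by (+ 0) (lemma a c e m) , refl
      where lemma : ∀ a c e m → a + c - e + m ≡ a + (c - e + m) + + 0 * (m + m)
            lemma = solve-∀
    assoc (a , true) (c , false) (e , false) = by (+ 0) (lemma a c e m) , refl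
      where lemma : ∀ a c e m → a - c - e ≡ a - (c + e) + + 0 * (m + m)
            lemma = solve-∀
    assoc (a , true) (c , false) (e , true) = by (+ 0) (lemma a c e m) , refl
      where lemma : ∀ a c e m → a - c - e + m ≡ a - (c + e) + m + + 0 * (m + m)
            lemma = solve-∀
    assoc (a , true) (c , true) (e , false) = by (+ 0) (lemma a c e m) , refl
      where lemma : ∀ a c e m → a - c + m + e ≡ a - (c - e) + m + + 0 * (m + m)
            lemma = solve-∀
    assoc (a , true) (c , true) (e , true) = by (+ 1) (lemma a c e m) , refl
      where lemma : ∀ a c e m → a - c + m + e ≡ a - (c - e + m) + + 1 * (m + m)
            lemma = solve-∀

    identityˡ : ∀ x → (+ 0 , false) ∙ x ≋ x
    identityˡ (a , b) = ≈-reflexive (ℤₚ.+-identityˡ a) , refl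

    identityʳ : ∀ x → x ∙ (+ 0 , false) ≋ x
    identityʳ (a , false) = ≈-reflexive (ℤₚ.+-identityʳ a) , refl
    identityʳ (a , true)  = ≈-reflexive (ℤₚ.+-identityʳ a) , refl

    inverseˡ : ∀ x → x ⁻¹ ∙ x ≋ (+ 0 , false)
    inverseˡ (a , false) = ≈-reflexive (ℤₚ.+-inverseˡ a) , refl
    inverseˡ (a , true) = by (+ 1) (lemma a m) , refl
      where lemma : ∀ a m → a + m - a + m ≡ + 0 + + 1 * (m + m)
            lemma = solve-∀

    inverseʳ : ∀ x → x ∙ x ⁻¹ ≋ (+ 0 , false)
    inverseʳ (a , false) = ≈-reflexive (ℤₚ.+-inverseʳ a) , refl
    inverseʳ (a , true) = by (+ 0) (lemma a m) , refl
      where lemma : ∀ a m → a - (a + m) + m ≡ + 0 + + 0 * (m + m)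
            lemma = solve-∀

  module DicyclicGroup (n : ℕ) {{nz : NonZero n}} where
    open Dicyclic n
    open Data.Integer using (+_; -[1+_]; -_; _+_; _-_; _*_; _⊖_)
    module Model = IntegerModel (+ n)
    open Model using (Elem; _≈_; by; _≋_; _,_; ≈-reflexive; ≈-sym; ≈-trans; ≋-refl; module ≋-Reasoning;
                      _∙_; _⁻¹; ∙-cong)

    N : ℕ
    N = 2 ℕ.* n

    private
      +N≡n+n : + N ≡ + n + + n
      +N≡n+n = trans (cong +_ (cong (n ℕ.+_) (ℕₚ.+-identityʳ n))) (ℤₚ.pos-+ n n)

    toℕ-md : ∀ x → toℕ (md x) ≡ x % N
    toℕ-md x = Finₚ.toℕ-fromℕ< (m%n<n x N)

    toℕ-md-< : ∀ {x} → x ℕ.< N → toℕ (md x) ≡ x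
    toℕ-md-< {x} x<N = trans (toℕ-md x) (m<n⇒m%n≡m x<N)

    n<N : n ℕ.< N
    n<N = ℕₚ.m<m+n n (ℕₚ.≤-trans (ℕ.>-nonZero⁻¹ n) (ℕₚ.m≤m+n n 0))

    md-toℕ : ∀ (i : Fin N) → md (toℕ i) ≡ i
    md-toℕ i = Finₚ.toℕ-injective (toℕ-md-< (Finₚ.toℕ<n i))

    md≈ : ∀ x → + toℕ (md x) ≈ + x
    md≈ x = ≈-sym (by (+ (x / N)) (begin
      + x                                       ≡⟨ cong +_ (m≡m%n+[m/n]*n x N) ⟩
      + (x % N ℕ.+ (x / N) ℕ.* N)               ≡⟨ ℤₚ.pos-+ (x % N) _ ⟩
      + (x % N) + + ((x / N) ℕ.* N)             ≡⟨ cong₂ _+_ (cong +_ (sym (toℕ-md x))) (ℤₚ.pos-* (x / N) N) ⟩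
      + toℕ (md x) + + (x / N) * + N            ≡⟨ cong (λ y → + toℕ (md x) + + (x / N) * y) +N≡n+n ⟩
      + toℕ (md x) + + (x / N) * (+ n + + n)    ∎))
      where open ≡-Reasoning

    private
      %-cong : ∀ x y k → + x ≡ + y + + k * (+ n + + n) → x % N ≡ y % N
      %-cong x y k eq = trans (cong (_% N) x≡) ([m+kn]%n≡m%n y k N)
        where
          x≡ : x ≡ y ℕ.+ k ℕ.* N
          x≡ = ℤₚ.+-injective (begin
            + x                        ≡⟨ eq ⟩
            + y + + k * (+ n + + n)    ≡⟨ cong (λ u → + y + + k * u) +N≡n+n ⟨
            + y + + k * + N            ≡⟨ cong (λ u → + y + u) (ℤₚ.pos-* k N) ⟨
            + y + + (k ℕ.* N)          ≡⟨ ℤₚ.pos-+ y (k ℕ.* N) ⟨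
            + (y ℕ.+ k ℕ.* N)          ∎)
            where open ≡-Reasoning

    md-cong : ∀ x y → + x ≈ + y → md x ≡ md y
    md-cong x y (by t eq) = Finₚ.toℕ-injective (trans (toℕ-md x) (trans (mods t eq) (sym (toℕ-md y))))
      where
        flip : ∀ x y s k → x ≡ y + - s * k → y ≡ x + s * k
        flip x y s k refl = lemma y s k
          where lemma : ∀ y s k → y ≡ y + - s * k + s * k
                lemma = solve-∀
        mods : ∀ t → + x ≡ + y + t * (+ n + + n) → x % N ≡ y % N
        mods (+ k) eq = %-cong x y k eq
        mods -[1+ k ] eq = sym (%-cong y x (suc k) (flip (+ x) (+ y) (+ suc k) (+ n + + n) eq))

    +neg : ∀ (k : Fin N) → + neg k ≡ (+ n + + n) - + toℕ k
    +neg k = begin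
      + (N ℕ.∸ toℕ k)       ≡⟨ ℤₚ.⊖-≥ (ℕₚ.<⇒≤ (Finₚ.toℕ<n k)) ⟨
      N ⊖ toℕ k             ≡⟨ ℤₚ.m-n≡m⊖n N (toℕ k) ⟨
      + N - + toℕ k         ≡⟨ cong (_- + toℕ k) +N≡n+n ⟩
      + n + + n - + toℕ k   ∎
      where open ≡-Reasoning

    emb : Dic → Elem
    emb (i , b) = + toℕ i , b

    emb-injective : ∀ {g h} → emb g ≋ emb h → g ≡ h
    emb-injective {i , b} {k , .b} (p , refl) =
      cong (_, b) (trans (sym (md-toℕ i)) (trans (md-cong _ _ p) (md-toℕ k)))

    emb-· : ∀ g h → emb (g · h) ≋ emb g ∙ emb h
    emb-· (i , false) (k , b) = ≈-trans (md≈ _) (≈-reflexive (ℤₚ.pos-+ (toℕ i) (toℕ k))) , refl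
    emb-· (i , true) (k , false) = ≈-trans (md≈ _) (by (+ 1) (begin
      + (toℕ i ℕ.+ neg k)                     ≡⟨ ℤₚ.pos-+ (toℕ i) (neg k) ⟩
      + toℕ i + + neg k                       ≡⟨ cong (λ r → + toℕ i + r) (+neg k) ⟩
      + toℕ i + (+ n + + n - + toℕ k)         ≡⟨ lemma (+ toℕ i) (+ toℕ k) (+ n) ⟩
      + toℕ i - + toℕ k + + 1 * (+ n + + n)   ∎)) , refl
      where
        open ≡-Reasoning
        lemma : ∀ a c m → a + (m + m - c) ≡ a - c + + 1 * (m + m)
        lemma = solve-∀
    emb-· (i , true) (k , true) = ≈-trans (md≈ _) (by (+ 1) (begin
      + (toℕ i ℕ.+ neg k ℕ.+ n)                       ≡⟨ ℤₚ.pos-+ (toℕ i ℕ.+ neg k) n ⟩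
      + (toℕ i ℕ.+ neg k) + + n                       ≡⟨ cong (_+ + n) (ℤₚ.pos-+ (toℕ i) (neg k)) ⟩
      + toℕ i + + neg k + + n                         ≡⟨ cong (λ r → + toℕ i + r + + n) (+neg k) ⟩
      + toℕ i + (+ n + + n - + toℕ k) + + n           ≡⟨ lemma (+ toℕ i) (+ toℕ k) (+ n) ⟩
      + toℕ i - + toℕ k + + n + + 1 * (+ n + + n)     ∎)) , refl
      where
        open ≡-Reasoning
        lemma : ∀ a c m → a + (m + m - c) + m ≡ a - c + m + + 1 * (m + m)
        lemma = solve-∀

    emb-inv : ∀ g → emb (inv g) ≋ emb g ⁻¹
    emb-inv (i , false) = ≈-trans (md≈ _) (by (+ 1) (trans (+neg i) (lemma (+ toℕ i) (+ n)))) , refl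
      where lemma : ∀ a m → m + m - a ≡ - a + + 1 * (m + m)
            lemma = solve-∀
    emb-inv (i , true) = ≈-trans (md≈ _) (≈-reflexive (ℤₚ.pos-+ (toℕ i) n)) , refl

    emb-one : emb one ≋ (+ 0 , false)
    emb-one = md≈ 0 , refl

    ·-assoc : ∀ g h k → (g · h) · k ≡ g · (h · k)
    ·-assoc g h k = emb-injective (begin
      emb ((g · h) · k)         ≈⟨ emb-· (g · h) k ⟩
      emb (g · h) ∙ emb k       ≈⟨ ∙-cong (emb-· g h) ≋-refl ⟩
      (emb g ∙ emb h) ∙ emb k   ≈⟨ Model.assoc (emb g) (emb h) (emb k) ⟩
      emb g ∙ (emb h ∙ emb k)   ≈⟨ ∙-cong ≋-refl (emb-· h k) ⟨
      emb g ∙ emb (h · k)       ≈⟨ emb-· g (h · k) ⟨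
      emb (g · (h · k))         ∎)
      where open ≋-Reasoning

    ·-identityˡ : ∀ g → one · g ≡ g
    ·-identityˡ g = emb-injective (begin
      emb (one · g)            ≈⟨ emb-· one g ⟩
      emb one ∙ emb g          ≈⟨ ∙-cong emb-one (≋-refl {emb g}) ⟩
      (+ 0 , false) ∙ emb g    ≈⟨ Model.identityˡ (emb g) ⟩
      emb g                    ∎)
      where open ≋-Reasoning

    ·-identityʳ : ∀ g → g · one ≡ g
    ·-identityʳ g = emb-injective (begin
      emb (g · one)            ≈⟨ emb-· g one ⟩
      emb g ∙ emb one          ≈⟨ ∙-cong (≋-refl {emb g}) emb-one ⟩
      emb g ∙ (+ 0 , false)    ≈⟨ Model.identityʳ (emb g) ⟩
      emb g                    ∎)
      where open ≋-Reasoning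

    inv-inverseˡ : ∀ g → inv g · g ≡ one
    inv-inverseˡ g = emb-injective (begin
      emb (inv g · g)          ≈⟨ emb-· (inv g) g ⟩
      emb (inv g) ∙ emb g      ≈⟨ ∙-cong (emb-inv g) (≋-refl {emb g}) ⟩
      emb g ⁻¹ ∙ emb g         ≈⟨ Model.inverseˡ (emb g) ⟩
      (+ 0 , false)            ≈⟨ emb-one ⟨
      emb one                  ∎)
      where open ≋-Reasoning

    inv-inverseʳ : ∀ g → g · inv g ≡ one
    inv-inverseʳ g = emb-injective (begin
      emb (g · inv g)          ≈⟨ emb-· g (inv g) ⟩
      emb g ∙ emb (inv g)      ≈⟨ ∙-cong (≋-refl {emb g}) (emb-inv g) ⟩
      emb g ∙ emb g ⁻¹         ≈⟨ Model.inverseʳ (emb g) ⟩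
      (+ 0 , false)            ≈⟨ emb-one ⟨
      emb one                  ∎)
      where open ≋-Reasoning

    isGroup : IsGroup _≡_ _·_ one inv
    isGroup = record
      { isMonoid = record
        { isSemigroup = record
          { isMagma = record { isEquivalence = isEquivalence ; ∙-cong = cong₂ _·_ }
          ; assoc = ·-assoc }
        ; identity = ·-identityˡ , ·-identityʳ }
      ; inverse = inv-inverseˡ , inv-inverseʳ
      ; ⁻¹-cong = cong inv }

    group : Group 0ℓ 0ℓ
    group = record { isGroup = isGroup }

    open GroupProperties group public
      using (\\-leftDividesˡ; \\-leftDividesʳ; ⁻¹-anti-homo-\\; ∙-cancelˡ; ε⁻¹≈ε)

    \\-cancelˡ : ∀ g u w → inv (g · u) · (g · w) ≡ inv u · w
    \\-cancelˡ g u w = begin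
      inv (g · u) · (g · w)          ≡⟨ cong (_· (g · w)) (GroupProperties.⁻¹-anti-homo-∙ group g u) ⟩
      (inv u · inv g) · (g · w)      ≡⟨ ·-assoc (inv u) (inv g) (g · w) ⟩
      inv u · (inv g · (g · w))      ≡⟨ cong (inv u ·_) (\\-leftDividesʳ g w) ⟩
      inv u · w                      ∎
      where open ≡-Reasoning

    ·-surjectiveˡ : ∀ g y → ∃ λ x → g · x ≡ y
    ·-surjectiveˡ g y = inv g · y , \\-leftDividesˡ g y

    proj₂-· : ∀ g h → proj₂ (g · h) ≡ proj₂ g xor proj₂ h
    proj₂-· (i , false) (k , b)     = refl
    proj₂-· (i , true)  (k , false) = refl
    proj₂-· (i , true)  (k , true)  = refl

    inCoset : Bool → Dic → Bool
    inCoset q x = not (proj₂ x xor q)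

    inCoset-· : ∀ q w y → inCoset q (w · y) ≡ inCoset (proj₂ w xor q) y
    inCoset-· q w y = cong not (begin
      proj₂ (w · y) xor q              ≡⟨ cong (_xor q) (proj₂-· w y) ⟩
      (proj₂ w xor proj₂ y) xor q      ≡⟨ cong (_xor q) (Boolₚ.xor-comm (proj₂ w) (proj₂ y)) ⟩
      (proj₂ y xor proj₂ w) xor q      ≡⟨ Boolₚ.xor-assoc (proj₂ y) (proj₂ w) q ⟩
      proj₂ y xor (proj₂ w xor q)      ∎)
      where open ≡-Reasoning

    infix 25 α^_

    α^_ : ℕ → Dic
    α^ j = md j , false

    β : Dic
    β = md 0 , true

    emb-α^ : ∀ j → emb (α^ j) ≋ (+ j , false)
    emb-α^ j = md≈ j , refl

    md-+ : ∀ a b → md (toℕ (md a) ℕ.+ toℕ (md b)) ≡ md (a ℕ.+ b)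
    md-+ a b = md-cong _ _ (≈-trans (≈-reflexive (ℤₚ.pos-+ (toℕ (md a)) (toℕ (md b))))
      (≈-trans (Model.+-cong (md≈ a) (md≈ b)) (≈-reflexive (sym (ℤₚ.pos-+ a b)))))

    α^-suc : ∀ j → α^ suc j ≡ α^ 1 · α^ j
    α^-suc j = cong (_, false) (sym (md-+ 1 j))

    α^toℕ·β : ∀ i → α^ toℕ i · β ≡ (i , true)
    α^toℕ·β i = cong (_, true) (trans (md-+ (toℕ i) 0) (trans (cong md (ℕₚ.+-identityʳ (toℕ i))) (md-toℕ i)))

    βinv·α^n : ∀ i → inv (i , true) · α^ n ≡ (i , true)
    βinv·α^n i = emb-injective (begin
      emb (inv (i , true) · α^ n)            ≈⟨ emb-· (inv (i , true)) (α^ n) ⟩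
      emb (inv (i , true)) ∙ emb (α^ n)      ≈⟨ ∙-cong (emb-inv (i , true)) (emb-α^ n) ⟩
      (+ toℕ i + + n , true) ∙ (+ n , false) ≈⟨ by (+ 0) (lemma (+ toℕ i) (+ n)) , refl ⟩
      emb (i , true)                         ∎)
      where
        open ≋-Reasoning
        lemma : ∀ a m → a + m - m ≡ a + + 0 * (m + m)
        lemma = solve-∀

    βinv·βinv : ∀ i → inv (i , true) · inv (i , true) ≡ α^ n
    βinv·βinv i = emb-injective (begin
      emb (inv (i , true) · inv (i , true))           ≈⟨ emb-· (inv (i , true)) (inv (i , true)) ⟩
      emb (inv (i , true)) ∙ emb (inv (i , true))     ≈⟨ ∙-cong (emb-inv (i , true)) (emb-inv (i , true)) ⟩
      (+ toℕ i + + n , true) ∙ (+ toℕ i + + n , true) ≈⟨ by (+ 0) (lemma (+ toℕ i) (+ n)) , refl ⟩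
      (+ n , false)                                   ≈⟨ emb-α^ n ⟨
      emb (α^ n)                                      ∎)
      where
        open ≋-Reasoning
        lemma : ∀ a m → a + m - (a + m) + m ≡ m + + 0 * (m + m)
        lemma = solve-∀

  module DicyclicElements (n : ℕ) {{nz : NonZero n}} where
    open Dicyclic n
    open DicyclicGroup n
    open Data.Nat using (_+_; _*_; _∸_)

    private
      pair : Fin N → List Dic
      pair i = (i , false) ∷ (i , true) ∷ []

    elements-complete : ∀ g → g ∈ elements
    elements-complete (i , b) = ∈-concatMap⁺ pair (Any.map (λ { refl → ∈-pair b }) (∈-allFin i))
      where
        ∈-pair : ∀ b → (i , b) ∈ pair i
        ∈-pair false = here refl
        ∈-pair true  = there (here refl)

    elements-unique : Unique elements
    elements-unique = unique (allFin N) (Unique.allFin⁺ N)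
      where
        fresh : ∀ {i} b L → All (i ≢_) L → All ((i , b) ≢_) (concatMap pair L)
        fresh b []      []         = []
        fresh b (j ∷ L) (i≢j ∷ ps) = (i≢j ∘ cong proj₁) ∷ (i≢j ∘ cong proj₁) ∷ fresh b L ps
        unique : ∀ L → Unique L → Unique (concatMap pair L)
        unique []      []        = []
        unique (i ∷ L) (ps ∷ us) = ((λ ()) ∷ fresh false L ps) ∷ fresh true L ps ∷ unique L us

    Σ-elements : ∀ f → Σ[ elements ] f ≡ ∑[ i < N ] (f (i , false) + f (i , true))
    Σ-elements f = trans (Σ-concat (allFin N)) (Σ-tabulate (λ i → i) (λ i → f (i , false) + f (i , true)))
      where
        Σ-concat : ∀ L → Σ[ concatMap pair L ] f ≡ Σ[ L ] (λ i → f (i , false) + f (i , true))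
        Σ-concat []      = refl
        Σ-concat (i ∷ L) = trans (sym (ℕₚ.+-assoc (f (i , false)) _ _)) (cong ((f (i , false) + f (i , true)) +_) (Σ-concat L))

    one≢α^n : one ≢ α^ n
    one≢α^n eq = ℕ.≢-nonZero⁻¹ n (begin
      n                ≡⟨ toℕ-md-< n<N ⟨
      toℕ (md n)       ≡⟨ cong (toℕ ∘ proj₁) eq ⟨
      toℕ (md 0)       ≡⟨ toℕ-md-< (ℕ.>-nonZero⁻¹ N) ⟩
      0                ∎)
      where open ≡-Reasoning

    inv-α-fixed : ∀ i → inv (i , false) ≡ (i , false) → (i , false) ≡ one ⊎ (i , false) ≡ α^ n
    inv-α-fixed i eq with toℕ i ℕₚ.≟ 0
    ... | yes x≡0 = inj₁ (cong (_, false) (Finₚ.toℕ-injective (trans x≡0 (sym (toℕ-md-< (ℕ.>-nonZero⁻¹ N))))))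
    ... | no x≢0  = inj₂ (cong (_, false) (Finₚ.toℕ-injective (trans (ℕₚ.*-cancelˡ-≡ (toℕ i) n 2 2i≡2n) (sym (toℕ-md-< n<N)))))
      where
        x = toℕ i
        x≤N : x ℕ.≤ N
        x≤N = ℕₚ.<⇒≤ (Finₚ.toℕ<n i)
        x≡N∸x : x ≡ N ∸ x
        x≡N∸x = begin
          x                 ≡⟨ cong (toℕ ∘ proj₁) eq ⟨
          toℕ (md (N ∸ x))  ≡⟨ toℕ-md-< (ℕₚ.∸-monoʳ-< {o = 0} (ℕₚ.n≢0⇒n>0 x≢0) x≤N) ⟩
          N ∸ x             ∎
          where open ≡-Reasoning
        2i≡2n : 2 * x ≡ 2 * n
        2i≡2n = begin
          x + (x + 0)       ≡⟨ cong (x +_) (ℕₚ.+-identityʳ x) ⟩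
          x + x             ≡⟨ cong (_+ x) x≡N∸x ⟩
          N ∸ x + x         ≡⟨ ℕₚ.m∸n+n≡m x≤N ⟩
          N                 ∎
          where open ≡-Reasoning

module CayleyDicyclic (n : ℕ) {{nz : NonZero n}} (S : Dicyclic.Dic n → Bool)
                      (connection : Dicyclic.ConnectionSet n S) where
  open Sums
  open FiniteGraphs
  open SquareBounds
  open DicyclicGroups
  open import Data.Bool using (Bool; true; false; not; _∧_; _∨_; _xor_; if_then_else_)
  import Data.Bool.Properties as Boolₚ
  open import Data.Empty using (⊥; ⊥-elim)
  open import Data.Fin using (Fin; toℕ)
  import Data.Fin.Properties as Finₚ
  open import Data.List using (allFin)
  open import Data.List.Membership.Propositional.Properties using (∈-allFin)
  open import Data.Nat using (ℕ; zero; suc; NonZero; _+_; _*_; _≤_; _<_; z≤n; s≤s)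
  import Data.Nat.Properties as ℕₚ
  open import Data.Nat.Tactic.RingSolver using (solve-∀)
  open import Data.Product using (∃; _,_; proj₁; proj₂)
  open import Data.Sum using (_⊎_; inj₁; inj₂; [_,_]′)
  open import Function using (_∘_; id)
  open import Relation.Binary.PropositionalEquality
  open import Relation.Binary.Structures using (IsEquivalence)
  open import Relation.Nullary using (¬_; yes; no)
  open import Relation.Nullary.Decidable using (⌊_⌋)
  open import Algebra.Properties.Semiring.Sum ℕₚ.+-*-semiring
    using (sum-syntax; ∑-distrib-+; *-distribˡ-sum; sum-cong-≗) renaming (sum to ∑)

  open Dicyclic n
  open DicyclicGroup n
  open DicyclicElements n
  open FiniteGraph elements _≟_ (cayAdj S)
  open FiniteGraphProperties elements _≟_ (cayAdj S) elements-complete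

  adj-one : ∀ w → cayAdj S one w ≡ S w
  adj-one w = cong S (trans (cong (_· w) ε⁻¹≈ε) (·-identityˡ w))

  adj-sym : ∀ u w → cayAdj S u w ≡ cayAdj S w u
  adj-sym u w = trans (proj₂ connection (inv u · w)) (cong S (⁻¹-anti-homo-\\ u w))

  adj-irreflexive : ∀ u → cayAdj S u u ≡ false
  adj-irreflexive u = trans (cong S (inv-inverseˡ u)) (proj₁ connection)

  adj-translate : ∀ g u w → cayAdj S (g · u) (g · w) ≡ cayAdj S u w
  adj-translate g u w = cong S (\\-cancelˡ g u w)

  module Translation (g : Dic) = Automorphism (g ·_) (∙-cancelˡ g _ _) (·-surjectiveˡ g) (adj-translate g)

  Dist-translate : ∀ d g u w → Dist d u w → Dist d (g · u) (g · w)
  Dist-translate d g u w D = trans (Translation.isDist-preserved g d u w) D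

  Dist-to-one : ∀ d u w → Dist d u w → Dist d one (inv u · w)
  Dist-to-one d u w D = subst (λ x → Dist d x (inv u · w)) (inv-inverseˡ u) (Dist-translate d (inv u) u w D)

  isDist-1-one : ∀ w → isDist 1 one w ≡ S w
  isDist-1-one w = trans (isDist-1 adj-irreflexive one w) (adj-one w)

  module _ (connected : ∀ u w → within 4 u w ≡ true) (regular : IntersectionRegular)
           (antipodal : Antipodal 4) (col : Dic → Bool) (proper : ∀ u w → Adj u w → col u ≡ not (col w))
           {h : Dic} (Dh : Dist 4 one h) where

    walks-within-⟨α⟩ : (∀ i → S (i , true) ≡ false) → ∀ k {w} → within k one w ≡ true → proj₂ w ≡ false
    walks-within-⟨α⟩ noβ zero    {w} eq = cong proj₂ (sym (Dist-0⇒≡ one w eq))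
    walks-within-⟨α⟩ noβ (suc k) {w} eq with ∨-true {within k one w} eq
    ... | inj₁ eqₖ = walks-within-⟨α⟩ noβ k eqₖ
    ... | inj₂ eqₖ with any-true⇒ _ elements eqₖ
    ... | y , _ , wy∧ay = let wy , ay = ∧-true {within k one y} wy∧ay in begin
      proj₂ w                                   ≡⟨ cong proj₂ (\\-leftDividesˡ y w) ⟨
      proj₂ (y · (inv y · w))                   ≡⟨ proj₂-· y (inv y · w) ⟩
      proj₂ y xor proj₂ (inv y · w)             ≡⟨ cong₂ _xor_ (walks-within-⟨α⟩ noβ k wy) (S⇒α (inv y · w) ay) ⟩
      false                                     ∎
      where
        open ≡-Reasoning
        S⇒α : ∀ x → S x ≡ true → proj₂ x ≡ false
        S⇒α (i , false) _  = refl
        S⇒α (i , true)  Sx = ⊥-elim (true≢false (trans (sym Sx) (noβ i)))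

    S-meets-β : ∃ λ i → S (i , true) ≡ true
    S-meets-β with search (λ i → S (i , true)) (allFin N) ∈-allFin
    ... | inj₁ found = found
    ... | inj₂ noβ   = ⊥-elim (true≢false (walks-within-⟨α⟩ noβ 4 (connected one β)))

    z : Dic
    z = α^ n

    adj-z-β : ∀ i → cayAdj S z (i , true) ≡ S (i , true)
    adj-z-β i = trans (adj-sym z (i , true)) (cong S (βinv·α^n i))

    s : Dic
    s = proj₁ S-meets-β , true

    adj-one-s : Adj one s
    adj-one-s = trans (adj-one s) (proj₂ S-meets-β)

    adj-s-z : Adj s z
    adj-s-z = trans (cong S (βinv·α^n (proj₁ S-meets-β))) (proj₂ S-meets-β)

    S-z : S z ≡ false
    S-z = ¬true⇒false λ Sz → Boolₚ.not-¬ refl (begin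
      col one              ≡⟨ proper one s adj-one-s ⟩
      not (col s)          ≡⟨ cong not (proper s z adj-s-z) ⟩
      not (not (col z))    ≡⟨ Boolₚ.not-involutive (col z) ⟩
      col z                ≡⟨ proper z one (trans (adj-sym z one) (trans (adj-one z) Sz)) ⟩
      not (col one)        ∎)
      where open ≡-Reasoning

    Dist-2-z : Dist 2 one z
    Dist-2-z = within⇒Dist-exact 2 one z (within-step 1 one s z (Adj⇒within-1 one s adj-one-s) adj-s-z) closer
      where
        closer : ∀ d → d < 2 → ¬ Dist d one z
        closer 0 _ D = one≢α^n (Dist-0⇒≡ one z D)
        closer 1 _ D = true≢false (trans (sym D) (trans (isDist-1-one z) S-z))
        closer (suc (suc d)) (s≤s (s≤s ())) _

    ¬Dist-4-z : ¬ Dist 4 one z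
    ¬Dist-4-z = Dist⇒¬Dist-suc {2} {3} one z (s≤s (s≤s z≤n)) Dist-2-z

    R : Dic → Dic → Set
    R u w = (isDist 0 u w ∨ isDist 4 u w) ≡ true

    R-translate : ∀ g {u w} → R u w → R (g · u) (g · w)
    R-translate g {u} {w} r = trans (cong₂ _∨_ (Translation.isDist-preserved g 0 u w) (Translation.isDist-preserved g 4 u w)) r

    -- x and x⁻¹ are antipodes of 1, hence of each other; translating by x⁻¹ makes 1 and x⁻² = αⁿ antipodes
    ¬Dist-4-β : ∀ i → ¬ Dist 4 one (i , true)
    ¬Dist-4-β i D = [ one≢α^n ∘ Dist-0⇒≡ one z , ¬Dist-4-z ]′ (∨-true r₄)
      where
        x = i , true
        open IsEquivalence antipodal renaming (sym to R-sym; trans to R-trans)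
        r₁ : R one x
        r₁ = ∨-trueʳ _ D
        r₂ : R one (inv x)
        r₂ = subst₂ R (inv-inverseˡ x) (·-identityʳ (inv x)) (R-translate (inv x) {x} {one} (R-sym {one} {x} r₁))
        r₄ : R one z
        r₄ = subst₂ R (inv-inverseˡ x) (βinv·βinv i)
               (R-translate (inv x) {x} {inv x} (R-trans {x} {one} {inv x} (R-sym {one} {x} r₁) r₂))

    -- if S ⊆ ⟨α⟩β, then b₂ vanishes at z but not on a geodesic from 1 to h
    S-meets-α : ∃ λ i → S (i , false) ≡ true
    S-meets-α with search (λ i → S (i , false)) (allFin N) ∈-allFin
    ... | inj₁ found = found
    ... | inj₂ noα   = ⊥-elim (ℕₚ.<-irrefl refl (subst (1 ≤_) no-b₂ (count-pos 3 one x₂ y₃ a₂ D₃)))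
      where
        y₃ = proj₁ (Dist-suc⇒pred 3 one h Dh)
        D₃ = proj₁ (proj₂ (Dist-suc⇒pred 3 one h Dh))
        x₂ = proj₁ (Dist-suc⇒pred 2 one y₃ D₃)
        D₂ = proj₁ (proj₂ (Dist-suc⇒pred 2 one y₃ D₃))
        a₂ = proj₂ (proj₂ (Dist-suc⇒pred 2 one y₃ D₃))
        z-has-no-b₂ : ∀ w → Adj z w → ¬ Dist 3 one w
        z-has-no-b₂ (i , false) a _ = true≢false (trans (sym a) (noα _))
        z-has-no-b₂ (i , true)  a = Dist⇒¬Dist-suc {1} {2} one (i , true) (s≤s z≤n) (trans (isDist-1-one (i , true)) (trans (sym (adj-z-β i)) a))
        no-b₂ : count 3 one x₂ ≡ 0
        no-b₂ = trans (sym (proj₂ (proj₂ (regular 2 one z one x₂ Dist-2-z D₂)))) (count-zero 3 one z z-has-no-b₂)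

    parity : Dic → Bool
    parity x = col one xor col x

    parity-Dist : ∀ d x → Dist d one x → parity x ≡ isOdd d
    parity-Dist d x = Dist⇒colour-xor col proper d one x

    parity-adj : ∀ x w → Adj x w → parity x ≡ not (parity w)
    parity-adj x w a = trans (cong (col one xor_) (proper x w a)) (sym (Boolₚ.not-distribʳ-xor (col one) (col w)))

    parity-· : ∀ g x → parity (g · x) ≡ parity g xor parity x
    parity-· g x with within⇒Dist 4 one x (connected one x)
    ... | d , _ , D = begin
      col one xor col (g · x)                            ≡⟨ xor-cancel-middle (col one) (col g) (col (g · x)) ⟨
      (col one xor col g) xor (col g xor col (g · x))    ≡⟨ cong (parity g xor_) (Dist⇒colour-xor col proper d g (g · x) Dg) ⟩
      parity g xor isOdd d                                    ≡⟨ cong (parity g xor_) (parity-Dist d x D) ⟨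
      parity g xor parity x                                        ∎
      where
        open ≡-Reasoning
        Dg : Dist d g (g · x)
        Dg = subst (λ u → Dist d u (g · x)) (·-identityʳ g) (Dist-translate d g one x D)
        xor-cancel-middle : ∀ a b c → (a xor b) xor (b xor c) ≡ a xor c
        xor-cancel-middle a b c = begin
          (a xor b) xor (b xor c)   ≡⟨ Boolₚ.xor-assoc a b (b xor c) ⟩
          a xor (b xor (b xor c))   ≡⟨ cong (a xor_) (Boolₚ.xor-assoc b b c) ⟨
          a xor ((b xor b) xor c)   ≡⟨ cong (λ t → a xor (t xor c)) (Boolₚ.xor-same b) ⟩
          a xor c                   ∎

    parity-α^ : ∀ j → parity (α^ j) ≡ isOdd j ∧ parity (α^ 1)
    parity-α^ zero    = Boolₚ.xor-same (col one)
    parity-α^ (suc j) = begin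
      parity (α^ suc j)                       ≡⟨ cong parity (α^-suc j) ⟩
      parity (α^ 1 · α^ j)                    ≡⟨ parity-· (α^ 1) (α^ j) ⟩
      parity (α^ 1) xor parity (α^ j)              ≡⟨ cong (parity (α^ 1) xor_) (parity-α^ j) ⟩
      parity (α^ 1) xor (isOdd j ∧ parity (α^ 1))  ≡⟨ xor-∧ (parity (α^ 1)) (isOdd j) ⟩
      not (isOdd j) ∧ parity (α^ 1)           ∎
      where
        open ≡-Reasoning
        xor-∧ : ∀ a p → a xor (p ∧ a) ≡ not p ∧ a
        xor-∧ false false = refl
        xor-∧ false true  = refl
        xor-∧ true  false = refl
        xor-∧ true  true  = refl

    parity-S : ∀ x → S x ≡ true → parity x ≡ true
    parity-S x Sx = parity-Dist 1 x (trans (isDist-1-one x) Sx)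

    parity-α^1 : parity (α^ 1) ≡ true
    parity-α^1 = proj₂ (∧-true (trans (sym (parity-α^ (toℕ i₀)))
      (trans (cong (parity ∘ (_, false)) (md-toℕ i₀)) (parity-S _ (proj₂ S-meets-α)))))
      where i₀ = proj₁ S-meets-α

    parity-α^-isOdd : ∀ j → parity (α^ j) ≡ isOdd j
    parity-α^-isOdd j = trans (parity-α^ j) (trans (cong (isOdd j ∧_) parity-α^1) (Boolₚ.∧-identityʳ (isOdd j)))

    parity-α : ∀ i → parity (i , false) ≡ isOdd (toℕ i)
    parity-α i = trans (cong (parity ∘ (_, false)) (sym (md-toℕ i))) (parity-α^-isOdd (toℕ i))

    parity-β : ∀ i → parity (i , true) ≡ isOdd (toℕ i) xor parity β
    parity-β i = trans (cong parity (sym (α^toℕ·β i))) (trans (parity-· (α^ toℕ i) β) (cong (_xor parity β) (parity-α^-isOdd (toℕ i))))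

    C : Dic → ℕ
    C x = count 1 one x

    c : ℕ
    c = C z

    k : ℕ
    k = Σ[ elements ] (𝟙 ∘ S)

    C-Σ : ∀ x → C x ≡ Σ[ elements ] (λ w → 𝟙 (cayAdj S x w ∧ S w))
    C-Σ x = trans (count-Σ 1 one x) (Σ-cong elements λ w → cong (λ b → 𝟙 (cayAdj S x w ∧ b)) (isDist-1-one w))

    C-one : C one ≡ k
    C-one = trans (C-Σ one) (Σ-cong elements λ w → cong 𝟙 (trans (cong (_∧ S w) (adj-one w)) (Boolₚ.∧-idem (S w))))

    C-odd : ∀ x → parity x ≡ true → C x ≡ 0
    C-odd x px = count-zero 1 one x λ w a D →
      true≢false (trans (sym px) (trans (parity-adj x w a) (cong not (parity-Dist 1 w D))))

    C-Dist-4 : ∀ x → Dist 4 one x → C x ≡ 0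
    C-Dist-4 x D = count-zero 1 one x λ w a D₁ →
      within⇒¬Dist-suc 3 one x
        (within-suc 2 one x (within-step 1 one w x (Dist⇒within 1 one w D₁) (trans (adj-sym w x) a))) D

    C-Dist-2 : ∀ x → Dist 2 one x → C x ≡ c
    C-Dist-2 x D = sym (proj₁ (regular 2 one z one x Dist-2-z D) 1 refl)

    C-even : ∀ x → parity x ≡ false → x ≢ one → C x ≡ c ⊎ Dist 4 one x
    C-even x px x≢one with within⇒Dist 4 one x (connected one x)
    ... | 0 , _ , D = ⊥-elim (x≢one (sym (Dist-0⇒≡ one x D)))
    ... | 1 , _ , D = ⊥-elim (true≢false (trans (sym (parity-Dist 1 x D)) px))
    ... | 2 , _ , D = inj₁ (C-Dist-2 x D)
    ... | 3 , _ , D = ⊥-elim (true≢false (trans (sym (parity-Dist 3 x D)) px))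
    ... | 4 , _ , D = inj₂ D
    ... | suc (suc (suc (suc (suc _)))) , s≤s (s≤s (s≤s (s≤s ()))) , _

    C-β : ∀ i → C (i , true) ≡ (if isOdd (toℕ i) xor parity β then 0 else c)
    C-β i with isOdd (toℕ i) xor parity β in eq
    ... | true  = C-odd (i , true) (trans (parity-β i) eq)
    ... | false = [ id , ⊥-elim ∘ ¬Dist-4-β i ]′ (C-even (i , true) (trans (parity-β i) eq) λ ())

    C-α-≤ : ∀ i → (i , false) ≢ one → C (i , false) ≤ (if isOdd (toℕ i) then 0 else c)
    C-α-≤ i i≢one with isOdd (toℕ i) in eq
    ... | true  = ℕₚ.≤-reflexive (C-odd (i , false) (trans (parity-α i) eq))
    ... | false = [ ℕₚ.≤-reflexive , (λ D → ℕₚ.≤-trans (ℕₚ.≤-reflexive (C-Dist-4 _ D)) z≤n) ]′ (C-even (i , false) (trans (parity-α i) eq) i≢one)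

    A : Bool → ℕ
    A q = Σ[ elements ] (λ y → 𝟙 (inCoset q y ∧ S y))

    T : Bool → ℕ
    T q = Σ[ elements ] (λ x → if inCoset q x then C x else 0)

    -- T q counts the edges between S and the coset picked out by inCoset q; the neighbours of w ∈ S are the w·y, y ∈ S
    T-double-count : ∀ q → T q ≡ A false * A q + A true * A (not q)
    T-double-count q = begin
      T q                                                       ≡⟨ Σ-cong elements (λ x → if-C x (inCoset q x)) ⟩
      Σ[ elements ] (λ x → Σ[ elements ] (λ w → 𝟙 (inCoset q x ∧ (cayAdj S x w ∧ S w))))
                                                                ≡⟨ Σ-swap elements elements _ ⟩
      Σ[ elements ] (λ w → Σ[ elements ] (λ x → 𝟙 (inCoset q x ∧ (cayAdj S x w ∧ S w))))
                                                                ≡⟨ Σ-cong elements neighbours-of-type ⟩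
      Σ[ elements ] (λ w → 𝟙 (S w) * A (proj₂ w xor q))         ≡⟨ Σ-cong elements split ⟩
      Σ[ elements ] (λ w → 𝟙 (inCoset false w ∧ S w) * A q + 𝟙 (inCoset true w ∧ S w) * A (not q))
                                                                ≡⟨ Σ-+ elements _ _ ⟩
      Σ[ elements ] (λ w → 𝟙 (inCoset false w ∧ S w) * A q) + Σ[ elements ] (λ w → 𝟙 (inCoset true w ∧ S w) * A (not q))
                                                                ≡⟨ cong₂ _+_ (Σ-*ʳ elements _ (A q)) (Σ-*ʳ elements _ (A (not q))) ⟩
      A false * A q + A true * A (not q)                        ∎
      where
        open ≡-Reasoning
        if-C : ∀ x t → (if t then C x else 0) ≡ Σ[ elements ] (λ w → 𝟙 (t ∧ (cayAdj S x w ∧ S w)))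
        if-C x true  = C-Σ x
        if-C x false = sym (Σ-zero elements)
        neighbours-of-type : ∀ w → Σ[ elements ] (λ x → 𝟙 (inCoset q x ∧ (cayAdj S x w ∧ S w)))
                                   ≡ 𝟙 (S w) * A (proj₂ w xor q)
        neighbours-of-type w with S w in Sw
        ... | false = trans (Σ-cong elements λ x → cong 𝟙 (trans (cong (inCoset q x ∧_) (Boolₚ.∧-zeroʳ _))
                        (Boolₚ.∧-zeroʳ _))) (Σ-zero elements)
        ... | true  = begin
          Σ[ elements ] (λ x → 𝟙 (inCoset q x ∧ (cayAdj S x w ∧ true)))
                                   ≡⟨ Σ-cong elements (λ x → cong (λ b → 𝟙 (inCoset q x ∧ b))
                                        (trans (Boolₚ.∧-identityʳ _) (adj-sym x w))) ⟩
          Σ[ elements ] (λ x → 𝟙 (inCoset q x ∧ cayAdj S w x))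
                                   ≡⟨ Σ-bijection elements elements-unique elements-complete (w ·_) (∙-cancelˡ w _ _)
                                        (·-surjectiveˡ w) _ ⟨
          Σ[ elements ] (λ y → 𝟙 (inCoset q (w · y) ∧ cayAdj S w (w · y)))
                                   ≡⟨ Σ-cong elements (λ y → cong₂ (λ a b → 𝟙 (a ∧ b)) (inCoset-· q w y)
                                        (cong S (\\-leftDividesʳ w y))) ⟩
          A (proj₂ w xor q)        ≡⟨ ℕₚ.*-identityˡ _ ⟨
          1 * A (proj₂ w xor q)    ∎
        split : ∀ w → 𝟙 (S w) * A (proj₂ w xor q) ≡ 𝟙 (inCoset false w ∧ S w) * A q + 𝟙 (inCoset true w ∧ S w) * A (not q)
        split (i , false) = sym (ℕₚ.+-identityʳ _)
        split (i , true)  = refl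

    A-β≤c : A true ≤ c
    A-β≤c = begin
      A true                                              ≤⟨ Σ-mono elements ≤-neighbour-of-z ⟩
      Σ[ elements ] (λ w → 𝟙 (cayAdj S z w ∧ S w))        ≡⟨ C-Σ z ⟨
      c                                                   ∎
      where
        open ℕₚ.≤-Reasoning
        ≤-neighbour-of-z : ∀ w → 𝟙 (inCoset true w ∧ S w) ≤ 𝟙 (cayAdj S z w ∧ S w)
        ≤-neighbour-of-z (i , false) = z≤n
        ≤-neighbour-of-z (i , true)  = ℕₚ.≤-reflexive (cong 𝟙
          (trans (sym (Boolₚ.∧-idem (S (i , true)))) (cong (_∧ S (i , true)) (sym (adj-z-β i)))))

    1≤A-β : 1 ≤ A true
    1≤A-β = ℕₚ.≤-trans (ℕₚ.≤-reflexive (cong 𝟙 (sym (proj₂ S-meets-β))))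
      (Σ-≥-term elements (λ y → 𝟙 (inCoset true y ∧ S y)) (elements-complete s))

    k-split : k ≡ A false + A true
    k-split = trans (Σ-cong elements by-type) (Σ-+ elements _ _)
      where
        by-type : ∀ w → 𝟙 (S w) ≡ 𝟙 (inCoset false w ∧ S w) + 𝟙 (inCoset true w ∧ S w)
        by-type (i , false) = sym (ℕₚ.+-identityʳ _)
        by-type (i , true)  = refl

    ∑-even : ∀ p → ∑[ i < N ] (if isOdd (toℕ i) xor p then 0 else c) ≡ n * c
    ∑-even p = trans (∑-periodic₂ g (λ j → cong (λ b → if b xor p then 0 else c) (Boolₚ.not-involutive (isOdd j))) n)
                     (cong (n *_) (g0+g1 p))
      where
        g : ℕ → ℕ
        g j = if isOdd j xor p then 0 else c
        g0+g1 : ∀ q → (if false xor q then 0 else c) + (if true xor q then 0 else c) ≡ c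
        g0+g1 false = ℕₚ.+-identityʳ c
        g0+g1 true  = refl

    T-β : T true ≡ n * c
    T-β = trans (Σ-elements _) (trans (sum-cong-≗ C-β) (∑-even (parity β)))

    ih : Fin N
    ih = proj₁ h

    h-α : Dist 4 one (ih , false)
    h-α = subst (Dist 4 one) (α-form h Dh) Dh
      where
        α-form : ∀ x → Dist 4 one x → x ≡ (proj₁ x , false)
        α-form (i , false) _ = refl
        α-form (i , true)  D = ⊥-elim (¬Dist-4-β i D)

    ih′ : Fin N
    ih′ = proj₁ (inv (ih , false))

    h′-α : Dist 4 one (ih′ , false)
    h′-α = subst (Dist 4 one) (·-identityʳ (inv (ih , false)))
      (Dist-to-one 4 (ih , false) one (Antipodal⇒Dist-sym 3 antipodal one (ih , false) h-α))

    i₀ : Fin N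
    i₀ = proj₁ one

    i₀≢ih : i₀ ≢ ih
    i₀≢ih eq = ¬Dist-suc-refl 3 one (subst (λ i → Dist 4 one (i , false)) (sym eq) h-α)

    i₀≢ih′ : i₀ ≢ ih′
    i₀≢ih′ eq = ¬Dist-suc-refl 3 one (subst (λ i → Dist 4 one (i , false)) (sym eq) h′-α)

    ih≢ih′ : ih ≢ ih′
    ih≢ih′ eq with inv-α-fixed ih (cong (_, false) (sym eq))
    ... | inj₁ h≡one = ¬Dist-suc-refl 3 one (subst (Dist 4 one) h≡one h-α)
    ... | inj₂ h≡z   = ¬Dist-4-z (subst (Dist 4 one) h≡z h-α)

    Y : Fin N → ℕ
    Y i = if isOdd (toℕ i) then 0 else c

    Y-even : ∀ d i → Dist d one (i , false) → isOdd d ≡ false → Y i ≡ c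
    Y-even d i D even = cong (λ b → if b then 0 else c) (trans (sym (parity-α i)) (trans (parity-Dist d _ D) even))

    δ : Fin N → Fin N → ℕ
    δ j i = 𝟙 ⌊ i Finₚ.≟ j ⌋

    antipode-bound : ∀ i → Dist 4 one (i , false) → C (i , false) + c * 1 ≤ Y i + k * 0
    antipode-bound i D = ℕₚ.≤-reflexive (begin
      C (i , false) + c * 1   ≡⟨ cong₂ _+_ (C-Dist-4 _ D) (ℕₚ.*-identityʳ c) ⟩
      c                       ≡⟨ Y-even 4 i D refl ⟨
      Y i                     ≡⟨ ℕₚ.+-identityʳ (Y i) ⟨
      Y i + 0                 ≡⟨ cong (Y i +_) (ℕₚ.*-zeroʳ k) ⟨
      Y i + k * 0             ∎)
      where open ≡-Reasoning

    -- Y bounds C on ⟨α⟩ except at 1, where C is k, and at the antipodes h, h⁻¹ of 1, where C is 0, not c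
    C-α-bound : ∀ i → C (i , false) + c * (δ i₀ i + (δ ih i + δ ih′ i)) ≤ Y i + k * δ i₀ i
    C-α-bound i with i Finₚ.≟ i₀ | i Finₚ.≟ ih | i Finₚ.≟ ih′
    ... | yes e₁   | yes e₂ | _      = ⊥-elim (i₀≢ih (trans (sym e₁) e₂))
    ... | yes e₁   | no _   | yes e₃ = ⊥-elim (i₀≢ih′ (trans (sym e₁) e₃))
    ... | no _     | yes e₂ | yes e₃ = ⊥-elim (ih≢ih′ (trans (sym e₂) e₃))
    ... | yes refl | no _   | no _   = ℕₚ.≤-reflexive (begin
      C one + c * 1      ≡⟨ cong₂ _+_ C-one (ℕₚ.*-identityʳ c) ⟩
      k + c              ≡⟨ ℕₚ.+-comm k c ⟩
      c + k              ≡⟨ cong₂ _+_ (sym (Y-even 0 i₀ (⌊≟⌋-refl _≟_ one) refl)) (sym (ℕₚ.*-identityʳ k)) ⟩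
      Y i₀ + k * 1       ∎)
      where open ≡-Reasoning
    ... | no _     | yes refl | no _     = antipode-bound ih h-α
    ... | no _     | no _     | yes refl = antipode-bound ih′ h′-α
    ... | no i≢i₀  | no _     | no _     = begin
      C (i , false) + c * 0    ≡⟨ cong (C (i , false) +_) (ℕₚ.*-zeroʳ c) ⟩
      C (i , false) + 0        ≡⟨ ℕₚ.+-identityʳ _ ⟩
      C (i , false)            ≤⟨ C-α-≤ i (i≢i₀ ∘ cong proj₁) ⟩
      Y i                      ≡⟨ ℕₚ.+-identityʳ _ ⟨
      Y i + 0                  ≡⟨ cong (Y i +_) (ℕₚ.*-zeroʳ k) ⟨
      Y i + k * 0              ∎
      where open ℕₚ.≤-Reasoning

    T-α-bound : T false + c * 3 ≤ n * c + k * 1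
    T-α-bound = begin
      T false + c * 3
        ≡⟨ cong₂ _+_ (trans (Σ-elements _) (sum-cong-≗ λ i → ℕₚ.+-identityʳ (C (i , false))))
                     (cong (c *_) (sym (cong₂ _+_ (∑-𝟙-≟ i₀) (cong₂ _+_ (∑-𝟙-≟ ih) (∑-𝟙-≟ ih′))))) ⟩
      ∑[ i < N ] C (i , false) + c * (∑[ i < N ] δ i₀ i + (∑[ i < N ] δ ih i + ∑[ i < N ] δ ih′ i))
        ≡⟨ cong (λ t → ∑[ i < N ] C (i , false) + c * (∑[ i < N ] δ i₀ i + t)) (∑-distrib-+ (δ ih) (δ ih′)) ⟨
      ∑[ i < N ] C (i , false) + c * (∑[ i < N ] δ i₀ i + ∑[ i < N ] (δ ih i + δ ih′ i))
        ≡⟨ cong (λ t → ∑[ i < N ] C (i , false) + c * t) (∑-distrib-+ (δ i₀) (λ i → δ ih i + δ ih′ i)) ⟨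
      ∑[ i < N ] C (i , false) + c * ∑[ i < N ] (δ i₀ i + (δ ih i + δ ih′ i))
        ≡⟨ cong (∑[ i < N ] C (i , false) +_) (*-distribˡ-sum c (λ i → δ i₀ i + (δ ih i + δ ih′ i))) ⟩
      ∑[ i < N ] C (i , false) + ∑[ i < N ] (c * (δ i₀ i + (δ ih i + δ ih′ i)))
        ≡⟨ ∑-distrib-+ (λ i → C (i , false)) _ ⟨
      ∑[ i < N ] (C (i , false) + c * (δ i₀ i + (δ ih i + δ ih′ i)))
        ≤⟨ ∑-mono C-α-bound ⟩
      ∑[ i < N ] (Y i + k * δ i₀ i)
        ≡⟨ ∑-distrib-+ Y (λ i → k * δ i₀ i) ⟩
      ∑[ i < N ] Y i + ∑[ i < N ] (k * δ i₀ i)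
        ≡⟨ cong₂ _+_ (trans (sum-cong-≗ {N} λ i → cong (λ b → if b then 0 else c) (sym (Boolₚ.xor-identityʳ (isOdd (toℕ i))))) (∑-even false))
                     (trans (sym (*-distribˡ-sum k (δ i₀))) (cong (k *_) (∑-𝟙-≟ i₀))) ⟩
      n * c + k * 1
        ∎
      where open ℕₚ.≤-Reasoning

    contradiction : ⊥
    contradiction = sum-of-squares-bound (A false) (A true) c 1≤A-β A-β≤c (begin
      A false * A false + A true * A true + 3 * c
        ≡⟨ cong₂ _+_ (T-double-count false) (ℕₚ.*-comm c 3) ⟨
      T false + c * 3
        ≤⟨ T-α-bound ⟩
      n * c + k * 1
        ≡⟨ cong₂ _+_ (trans (sym T-β) (T-double-count true)) (trans (ℕₚ.*-identityʳ k) k-split) ⟩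
      A false * A true + A true * A false + (A false + A true)
        ≡⟨ cong (_+ (A false + A true)) (double (A false) (A true)) ⟩
      2 * (A false * A true) + (A false + A true)
        ∎)
      where
        open ℕₚ.≤-Reasoning
        double : ∀ a b → a * b + b * a ≡ 2 * (a * b)
        double = solve-∀

lemma3p8 : (n : ℕ) {{nz : NonZero n}} (S : Dicyclic.Dic n → Bool) →
    Dicyclic.ConnectionSet n S →
    ¬ (CayDic.DistanceRegularOfDiameter n S 4 × CayDic.Antipodal n S 4 × CayDic.Bipartite n S)
lemma3p8 n S connection (((connected , u , v , D) , regular) , antipodal , col , proper) =
  contradiction connected regular antipodal col proper (Dist-to-one 4 u v D)
  where open CayleyDicyclic n S connection
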